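{- The categories $\mathbf{CIS}$ and $\mathbf{SIF}$ are equivalent.
   Context: A simplified continuous information system is a triple $(S,\mathrm{CON},\Vdash)$ with $S$ a set, $\mathrm{CON}$ a collection of finite subsets of $S$ and $\Vdash\subseteq\mathrm{CON}\times S$, such that for all $X,Y\in\mathrm{CON}$, $a\in S$ and finite $F\subseteq S$ (writing $X\Vdash Y$ iff $X\Vdash b$ for all $b\in Y$): (1) $\{a\}\in\mathrm{CON}$; (2) if $X\subseteq Y$ and $X\Vdash a$ then $Y\Vdash a$; (3) if $X\Vdash Y$ and $Y\Vdash a$ then $X\Vdash a$; (4) if $X\Vdash a$ then there is $Z\in\mathrm{CON}$ with $X\Vdash Z$ and $Z\Vdash a$; (5) if $X\Vdash F$ then there is $Z\in\mathrm{CON}$ with $F\subseteq Z$ and $X\Vdash Z$. It is a continuous information system if moreover $X\Vdash a$ implies $X\cup\{a\}\in\mathrm{CON}$. An approximable mapping $H$ from $(S,\mathrm{CON},\Vdash)$ to $(S',\mathrm{CON}',\Vdash')$ is a relation $H\subseteq\mathrm{CON}\times S'$ (write $XHF$ iff $XHb$ for all $b\in F$) such that for all $X,X'\in\mathrm{CON}$, $Y\in\mathrm{CON}'$, $b\in S'$ and finite $F\subseteq S'$: (a) $XHY$ and $Y\Vdash' b$ imply $XHb$; (b) $X\supseteq X'$ and $X'Hb$ imply $XHb$; (c) $X\Vdash X'$ and $X'Hb$ imply $XHb$; (d) if $XHb$ there are $Z\in\mathrm{CON}$, $Z'\in\mathrm{CON}'$ with $X\Vdash Z$, $ZHZ'$,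 $Z'\Vdash' b$; (e) if $XHF$ there is $Z\in\mathrm{CON}'$ with $F\subseteq Z$ and $XHZ$. $\mathbf{CIS}$ is the category of continuous information systems and approximable mappings (composition = relational composition, identity on $\mathbb S$ = its $\Vdash$). A continuous information frame is a triple $\mathbb{A}=(A,(\mathrm{Con}_i)_{i\in A},(\vDash_i)_{i\in A})$ where $A$ is a set, each $\mathrm{Con}_i$ is a set of finite subsets of $A$, and $\vDash_i\subseteq\mathrm{Con}_i\times A$; write $iRj$ iff $\{i\}\in\mathrm{Con}_j$, and $X\vDash_i Y$ iff $X\vDash_i b$ for all $b\in Y$. Required, for all $i,j,a\in A$ and finite $X,Y\subseteq A$: (i) $\{i\}\in\mathrm{Con}_i$; (ii) if $Y\subseteq X\in\mathrm{Con}_i$ then $Y\in\mathrm{Con}_i$; (iii) if $X\in\mathrm{Con}_i$ and $X\vDash_i Y$ then $Y\in\mathrm{Con}_i$; (iv) if $X,Y\in\mathrm{Con}_i$, $X\subseteq Y$, $X\vDash_i a$ then $Y\vDash_i a$; (v) if $X\in\mathrm{Con}_i$, $X\vDash_i Y$, $Y\vDash_i a$ then $X\vDash_i a$; (vi) if $iRj$ then $\mathrm{Con}_i\subseteq\mathrm{Con}_j$; (vii) if $iRj$, $X\in\mathrm{Con}_i$, $X\vDash_i a$ then $X\vDash_j a$; (viii) if $X\vDash_i Y$ then there exist $e\in A$, $Z\in\mathrm{Con}_e$ with $X\vDash_i \{e\}\cup Z$ and $Z\vDash_e Y$. It is strong if for all $i$ and $X\in\mathrm{Con}_i$ with $X\neq\{i\}$,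 $\{i\}\vDash_i X$. An approximable family $\mathbb H=(H_i)_{i\in A}$ from $\mathbb A$ to $\mathbb A'$ is a family of relations $H_i\subseteq\mathrm{Con}_i\times A'$ (write $XH_iY$ iff $XH_ic$ for all $c\in Y$) such that for all $i,j\in A$, $X,X'\in\mathrm{Con}_i$, $b,k\in A'$, $Y\in\mathrm{Con}'_k$, finite $F\subseteq A'$: (a) $XH_i(\{k\}\cup Y)$ and $Y\vDash'_k b$ imply $XH_ib$; (b) $X\subseteq X'$ and $XH_ib$ imply $X'H_ib$; (c) $X\vDash_iX'$ and $X'H_ib$ imply $XH_ib$; (d) $iRj$ and $XH_ib$ imply $XH_jb$; (e) if $XH_iF$ there are $c\in A$, $e\in A'$, $U\in\mathrm{Con}_c$, $V\in\mathrm{Con}'_e$ with $X\vDash_i\{c\}\cup U$, $UH_c(\{e\}\cup V)$, $V\vDash'_eF$. Composition of $\mathbb G:\mathbb A^{(1)}\to\mathbb A^{(2)}$ and $\mathbb H:\mathbb A^{(2)}\to\mathbb A^{(3)}$: $X(\mathbb G\circ\mathbb H)_ia$ iff there are $e\in A^{(2)}$, $V\in\mathrm{Con}^{(2)}_e$ with $XG_i(\{e\}\cup V)$ and $VH_ea$; identity on $\mathbb A$ is $(\vDash_i)_{i\in A}$. $\mathbf{SIF}$ is the category of strong continuous information frames and approximable families. -}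

module Defs where

open import Data.List using (List; []; _∷_)
open import Data.List.Membership.Propositional using (_∈_)
open import Data.Product using (Σ; _×_; _,_; Σ-syntax)
open import Relation.Nullary using (¬_)
open import Function.Bundles using (_⇔_)

-- Finite subsets of a set S are represented by lists over S,
-- compared extensionally (same elements).

_⊆_ : {S : Set} → List S → List S → Set
X ⊆ Y = ∀ {a} → a ∈ X → a ∈ Y

_≐_ : {S : Set} → List S → List S → Set
X ≐ Y = (X ⊆ Y) × (Y ⊆ X)

_⟨_⟩*_ : {S T : Set} → List S → (List S → T → Set) → List T → Set
X ⟨ R ⟩* Y = ∀ {b} → b ∈ Y → R X b

record CIS : Set₁ where
  field
    S   : Set
    CON : List S → Set
    entC : List S → S → Set
  field
    -- CON is a collection of finite *subsets*: invariant under ≐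
    CON-ext : ∀ {X Y} → X ≐ Y → CON X → CON Y
    entC-dom : ∀ {X a} → entC X a → CON X
    ax1 : ∀ a → CON (a ∷ [])
    ax2 : ∀ {X Y a} → CON X → CON Y → X ⊆ Y → entC X a → entC Y a
    ax3 : ∀ {X Y a} → CON X → CON Y → X ⟨ entC ⟩* Y → entC Y a → entC X a
    ax4 : ∀ {X a} → CON X → entC X a →
          Σ[ Z ∈ List S ] (CON Z × X ⟨ entC ⟩* Z × entC Z a)
    ax5 : ∀ {X F} → CON X → X ⟨ entC ⟩* F →
          Σ[ Z ∈ List S ] (CON Z × F ⊆ Z × X ⟨ entC ⟩* Z)
    cont : ∀ {X a} → CON X → entC X a → CON (a ∷ X)

open CIS

record ApproxMap (𝕊 𝕊' : CIS) : Set₁ where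
  field
    HC : List (S 𝕊) → S 𝕊' → Set
    HC-dom : ∀ {X b} → HC X b → CON 𝕊 X
    am-a : ∀ {X Y b} → CON 𝕊 X → CON 𝕊' Y → X ⟨ HC ⟩* Y → entC 𝕊' Y b → HC X b
    am-b : ∀ {X X' b} → CON 𝕊 X → CON 𝕊 X' → X' ⊆ X → HC X' b → HC X b
    am-c : ∀ {X X' b} → CON 𝕊 X → CON 𝕊 X' → X ⟨ entC 𝕊 ⟩* X' → HC X' b → HC X b
    am-d : ∀ {X b} → CON 𝕊 X → HC X b →
           Σ[ Z ∈ List (S 𝕊) ] Σ[ Z' ∈ List (S 𝕊') ]
             (CON 𝕊 Z × CON 𝕊' Z' × X ⟨ entC 𝕊 ⟩* Z × Z ⟨ HC ⟩* Z' × entC 𝕊' Z' b)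
    am-e : ∀ {X F} → CON 𝕊 X → X ⟨ HC ⟩* F →
           Σ[ Z ∈ List (S 𝕊') ] (CON 𝕊' Z × F ⊆ Z × X ⟨ HC ⟩* Z)

open ApproxMap

RelC : CIS → CIS → Set₁
RelC 𝕊 𝕊' = List (S 𝕊) → S 𝕊' → Set

idC : (𝕊 : CIS) → RelC 𝕊 𝕊
idC 𝕊 = entC 𝕊

compC : (𝕊₁ 𝕊₂ 𝕊₃ : CIS) → RelC 𝕊₁ 𝕊₂ → RelC 𝕊₂ 𝕊₃ → RelC 𝕊₁ 𝕊₃
compC 𝕊₁ 𝕊₂ 𝕊₃ G H X c = Σ[ Y ∈ List (S 𝕊₂) ] (CON 𝕊₂ Y × X ⟨ G ⟩* Y × H Y c)

EqC : (𝕊 𝕊' : CIS) → RelC 𝕊 𝕊' → RelC 𝕊 𝕊' → Set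
EqC 𝕊 𝕊' R R' = ∀ X → CON 𝕊 X → ∀ b → R X b ⇔ R' X b

record SCIF : Set₁ where
  field
    A   : Set
    Con : A → List A → Set
    entF : A → List A → A → Set
  R : A → A → Set
  R i j = Con j (i ∷ [])
  ent* : A → List A → List A → Set
  ent* i X Y = X ⟨ entF i ⟩* Y
  field
    entF-dom : ∀ {i X a} → entF i X a → Con i X
    f1 : ∀ i → Con i (i ∷ [])
    f2 : ∀ {i X Y} → Y ⊆ X → Con i X → Con i Y
    f3 : ∀ {i X Y} → Con i X → ent* i X Y → Con i Y
    f4 : ∀ {i X Y a} → Con i X → Con i Y → X ⊆ Y → entF i X a → entF i Y a
    f5 : ∀ {i X Y a} → Con i X → ent* i X Y → entF i Y a → entF i X a
    f6 : ∀ {i j} → R i j → ∀ {X} → Con i X → Con j X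
    f7 : ∀ {i j X a} → R i j → Con i X → entF i X a → entF j X a
    f8 : ∀ {i X Y} → Con i X → ent* i X Y →
         Σ[ e ∈ A ] Σ[ Z ∈ List A ] (Con e Z × ent* i X (e ∷ Z) × ent* e Z Y)
    strong : ∀ {i X} → Con i X → ¬ (X ≐ (i ∷ [])) → ent* i (i ∷ []) X

open SCIF

record ApproxFam (𝔸 𝔸' : SCIF) : Set₁ where
  field
    HF : A 𝔸 → List (A 𝔸) → A 𝔸' → Set
  H* : A 𝔸 → List (A 𝔸) → List (A 𝔸') → Set
  H* i X Y = X ⟨ HF i ⟩* Y
  field
    HF-dom : ∀ {i X b} → HF i X b → Con 𝔸 i X
    af-a : ∀ {i X k Y b} → Con 𝔸 i X → Con 𝔸' k Y →
           H* i X (k ∷ Y) → entF 𝔸' k Y b → HF i X b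
    af-b : ∀ {i X X' b} → Con 𝔸 i X → Con 𝔸 i X' → X ⊆ X' → HF i X b → HF i X' b
    af-c : ∀ {i X X' b} → Con 𝔸 i X → Con 𝔸 i X' →
           ent* 𝔸 i X X' → HF i X' b → HF i X b
    af-d : ∀ {i j X b} → R 𝔸 i j → Con 𝔸 i X → HF i X b → HF j X b
    af-e : ∀ {i X F} → Con 𝔸 i X → H* i X F →
           Σ[ c ∈ A 𝔸 ] Σ[ e ∈ A 𝔸' ] Σ[ U ∈ List (A 𝔸) ] Σ[ V ∈ List (A 𝔸') ]
             (Con 𝔸 c U × Con 𝔸' e V × ent* 𝔸 i X (c ∷ U) ×
              H* c U (e ∷ V) × ent* 𝔸' e V F)

open ApproxFam

RelF : SCIF → SCIF → Set₁
RelF 𝔸 𝔸' = A 𝔸 → List (A 𝔸) → A 𝔸' → Set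

idF : (𝔸 : SCIF) → RelF 𝔸 𝔸
idF 𝔸 = entF 𝔸

compF : (𝔸₁ 𝔸₂ 𝔸₃ : SCIF) → RelF 𝔸₁ 𝔸₂ → RelF 𝔸₂ 𝔸₃ → RelF 𝔸₁ 𝔸₃
compF 𝔸₁ 𝔸₂ 𝔸₃ G H i X a =
  Σ[ e ∈ A 𝔸₂ ] Σ[ V ∈ List (A 𝔸₂) ] (Con 𝔸₂ e V × X ⟨ G i ⟩* (e ∷ V) × H e V a)

EqF : (𝔸 𝔸' : SCIF) → RelF 𝔸 𝔸' → RelF 𝔸 𝔸' → Set
EqF 𝔸 𝔸' R R' = ∀ i X → Con 𝔸 i X → ∀ b → R i X b ⇔ R' i X b

record CIS≃SIF : Set₂ where
  field
    F₀ : CIS → SCIF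
    F₁ : ∀ {𝕊 𝕊'} → ApproxMap 𝕊 𝕊' → ApproxFam (F₀ 𝕊) (F₀ 𝕊')
    F-resp : ∀ {𝕊 𝕊'} (H H' : ApproxMap 𝕊 𝕊') →
             EqC 𝕊 𝕊' (H .HC) (H' .HC) →
             EqF (F₀ 𝕊) (F₀ 𝕊') (F₁ H .HF) (F₁ H' .HF)
    F-id : ∀ {𝕊} (I : ApproxMap 𝕊 𝕊) →
           EqC 𝕊 𝕊 (I .HC) (idC 𝕊) →
           EqF (F₀ 𝕊) (F₀ 𝕊) (F₁ I .HF) (idF (F₀ 𝕊))
    F-comp : ∀ {𝕊₁ 𝕊₂ 𝕊₃} (G : ApproxMap 𝕊₁ 𝕊₂) (H : ApproxMap 𝕊₂ 𝕊₃)
             (K : ApproxMap 𝕊₁ 𝕊₃) →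
             EqC 𝕊₁ 𝕊₃ (K .HC) (compC 𝕊₁ 𝕊₂ 𝕊₃ (G .HC) (H .HC)) →
             EqF (F₀ 𝕊₁) (F₀ 𝕊₃) (F₁ K .HF)
               (compF (F₀ 𝕊₁) (F₀ 𝕊₂) (F₀ 𝕊₃) (F₁ G .HF) (F₁ H .HF))
    G₀ : SCIF → CIS
    G₁ : ∀ {𝔸 𝔸'} → ApproxFam 𝔸 𝔸' → ApproxMap (G₀ 𝔸) (G₀ 𝔸')
    G-resp : ∀ {𝔸 𝔸'} (H H' : ApproxFam 𝔸 𝔸') →
             EqF 𝔸 𝔸' (H .HF) (H' .HF) →
             EqC (G₀ 𝔸) (G₀ 𝔸') (G₁ H .HC) (G₁ H' .HC)
    G-id : ∀ {𝔸} (I : ApproxFam 𝔸 𝔸) →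
           EqF 𝔸 𝔸 (I .HF) (idF 𝔸) →
           EqC (G₀ 𝔸) (G₀ 𝔸) (G₁ I .HC) (idC (G₀ 𝔸))
    G-comp : ∀ {𝔸₁ 𝔸₂ 𝔸₃} (G : ApproxFam 𝔸₁ 𝔸₂) (H : ApproxFam 𝔸₂ 𝔸₃)
             (K : ApproxFam 𝔸₁ 𝔸₃) →
             EqF 𝔸₁ 𝔸₃ (K .HF) (compF 𝔸₁ 𝔸₂ 𝔸₃ (G .HF) (H .HF)) →
             EqC (G₀ 𝔸₁) (G₀ 𝔸₃) (G₁ K .HC)
               (compC (G₀ 𝔸₁) (G₀ 𝔸₂) (G₀ 𝔸₃) (G₁ G .HC) (G₁ H .HC))
    η  : ∀ 𝕊 → ApproxMap 𝕊 (G₀ (F₀ 𝕊))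
    η⁻ : ∀ 𝕊 → ApproxMap (G₀ (F₀ 𝕊)) 𝕊
    η-inv₁ : ∀ 𝕊 → EqC 𝕊 𝕊
               (compC 𝕊 (G₀ (F₀ 𝕊)) 𝕊 (η 𝕊 .HC) (η⁻ 𝕊 .HC)) (idC 𝕊)
    η-inv₂ : ∀ 𝕊 → EqC (G₀ (F₀ 𝕊)) (G₀ (F₀ 𝕊))
               (compC (G₀ (F₀ 𝕊)) 𝕊 (G₀ (F₀ 𝕊)) (η⁻ 𝕊 .HC) (η 𝕊 .HC))
               (idC (G₀ (F₀ 𝕊)))
    η-nat : ∀ {𝕊 𝕊'} (H : ApproxMap 𝕊 𝕊') →
            EqC 𝕊 (G₀ (F₀ 𝕊'))
              (compC 𝕊 𝕊' (G₀ (F₀ 𝕊')) (H .HC) (η 𝕊' .HC))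
              (compC 𝕊 (G₀ (F₀ 𝕊)) (G₀ (F₀ 𝕊')) (η 𝕊 .HC) (G₁ (F₁ H) .HC))
    ε  : ∀ 𝔸 → ApproxFam (F₀ (G₀ 𝔸)) 𝔸
    ε⁻ : ∀ 𝔸 → ApproxFam 𝔸 (F₀ (G₀ 𝔸))
    ε-inv₁ : ∀ 𝔸 → EqF (F₀ (G₀ 𝔸)) (F₀ (G₀ 𝔸))
               (compF (F₀ (G₀ 𝔸)) 𝔸 (F₀ (G₀ 𝔸)) (ε 𝔸 .HF) (ε⁻ 𝔸 .HF))
               (idF (F₀ (G₀ 𝔸)))
    ε-inv₂ : ∀ 𝔸 → EqF 𝔸 𝔸
               (compF 𝔸 (F₀ (G₀ 𝔸)) 𝔸 (ε⁻ 𝔸 .HF) (ε 𝔸 .HF)) (idF 𝔸)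
    ε-nat : ∀ {𝔸 𝔸'} (H : ApproxFam 𝔸 𝔸') →
            EqF (F₀ (G₀ 𝔸)) 𝔸'
              (compF (F₀ (G₀ 𝔸)) (F₀ (G₀ 𝔸')) 𝔸' (F₁ (G₁ H) .HF) (ε 𝔸' .HF))
              (compF (F₀ (G₀ 𝔸)) 𝔸 𝔸' (ε 𝔸 .HF) (H .HF))

{-# OPTIONS --safe #-}
module Submission where

-- A system 𝕊 becomes the frame whose tokens are the consistent sets of 𝕊: L is consistent at z
-- when L ⊆ {z} or z ⊩ every member of L, and then L ⊨_z t just when z ⊩ t. A frame 𝔸 becomes the system whose tokens are the pointed
-- consistent sets (i, X), X ∈ Con_i, preordered by (i, X) ▷ (j, Y) iff X ⊨_i {j} ∪ Y; a finite set
-- of them is consistent iff it has a ▷-greatest element, and it entails t iff that element ▷ t. The unit relates X to (i, Z) iff X ⊩ every set in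
-- {i} ∪ Z; the counit relates L at z to b iff the greatest element of z entails b. Every
-- existential demanded by the axioms is met by interpolation, using that the consistent sets
-- reachable from a fixed one are directed, so that finitely many witnesses merge into one.

open import Defs
open import Data.List using (List; []; _∷_; _++_)
open import Data.List.Membership.Propositional using (_∈_)
open import Data.List.Membership.Propositional.Properties using (∈-++⁺ˡ; ∈-++⁺ʳ; ∈-++⁻)
open import Data.List.Relation.Unary.Any using (here; there)
open import Data.List.Relation.Unary.Any.Properties using (singleton⁻)
open import Data.Product using (Σ; _×_; _,_; proj₁; proj₂; Σ-syntax)
open import Data.Sum using (_⊎_; inj₁; inj₂; [_,_]′)
open import Data.Empty using (⊥-elim)
open import Relation.Nullary using (¬_)
open import Relation.Binary.PropositionalEquality using (_≡_; refl; sym; subst)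
open import Function.Bundles using (mk⇔; Equivalence)

open CIS
open SCIF
open ApproxMap
open ApproxFam hiding (H*)
open Equivalence using (to; from)

∀∈-++ : {T : Set} {P : T → Set} (xs : List T) {ys : List T} →
        (∀ {x} → x ∈ xs → P x) → (∀ {y} → y ∈ ys → P y) →
        ∀ {z} → z ∈ xs ++ ys → P z
∀∈-++ xs p q m = [ p , q ]′ (∈-++⁻ xs m)

module Directed {T : Set} (Reach : T → Set) (_≼_ : T → T → Set)
                (inhabited : Σ T Reach)
                (join : ∀ {u v} → Reach u → Reach v → Σ[ w ∈ T ] (Reach w × u ≼ w × v ≼ w))
                where

  merge : {I : Set} (P : T → I → Set) →
          (∀ {u w x} → Reach u → Reach w → u ≼ w → P u x → P w x) →
          (xs : List I) → (∀ {x} → x ∈ xs → Σ[ u ∈ T ] (Reach u × P u x)) →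
          Σ[ u ∈ T ] (Reach u × (∀ {x} → x ∈ xs → P u x))
  merge P mono [] _ = proj₁ inhabited , proj₂ inhabited , λ ()
  merge P mono (x ∷ xs) witness
    with witness (here refl) | merge P mono xs (λ m → witness (there m))
  ... | u , ru , pu | v , rv , pv with join ru rv
  ... | w , rw , u≼w , v≼w =
    w , rw , λ { (here refl) → mono ru rw u≼w pu ; (there m) → mono rv rw v≼w (pv m) }

-- Continuous information systems

ConSet : CIS → Set
ConSet 𝕊 = Σ (List (S 𝕊)) (CON 𝕊)

idMap : (𝕊 : CIS) → ApproxMap 𝕊 𝕊
idMap 𝕊 = record
  { HC = entC 𝕊
  ; HC-dom = entC-dom 𝕊
  ; am-a = ax3 𝕊
  ; am-b = λ cX cX' X'⊆X → ax2 𝕊 cX' cX X'⊆X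
  ; am-c = ax3 𝕊
  ; am-d = interpolate₂
  ; am-e = ax5 𝕊
  }
  where
  interpolate₂ : ∀ {X b} → CON 𝕊 X → entC 𝕊 X b →
                 Σ[ Z ∈ List (S 𝕊) ] Σ[ Z' ∈ List (S 𝕊) ]
                   (CON 𝕊 Z × CON 𝕊 Z' × X ⟨ entC 𝕊 ⟩* Z × Z ⟨ entC 𝕊 ⟩* Z' × entC 𝕊 Z' b)
  interpolate₂ cX X⊩b with ax4 𝕊 cX X⊩b
  ... | Z , cZ , X⊩Z , Z⊩b with ax4 𝕊 cZ Z⊩b
  ... | Z' , cZ' , Z⊩Z' , Z'⊩b = Z , Z' , cZ , cZ' , X⊩Z , Z⊩Z' , Z'⊩b

module Image {𝕊 𝕋 : CIS} (H : ApproxMap 𝕊 𝕋) {X : List (S 𝕊)} (cX : CON 𝕊 X) where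

  InImage : List (S 𝕋) → Set
  InImage Y = CON 𝕋 Y × X ⟨ HC H ⟩* Y

  merge : {I : Set} (P : List (S 𝕋) → I → Set) →
          (∀ {Y Y' x} → CON 𝕋 Y → CON 𝕋 Y' → Y ⊆ Y' → P Y x → P Y' x) →
          (xs : List I) → (∀ {x} → x ∈ xs → Σ[ Y ∈ List (S 𝕋) ] (InImage Y × P Y x)) →
          Σ[ Y ∈ List (S 𝕋) ] (InImage Y × (∀ {x} → x ∈ xs → P Y x))
  merge P mono = Directed.merge InImage _⊆_ empty join P (λ (cY , _) (cY' , _) → mono cY cY')
    where
    empty : Σ (List (S 𝕋)) InImage
    empty with am-e H {F = []} cX (λ ())
    ... | Y , cY , _ , XHY = Y , cY , XHY
    join : ∀ {Y Y'} → InImage Y → InImage Y' →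
           Σ[ Z ∈ List (S 𝕋) ] (InImage Z × Y ⊆ Z × Y' ⊆ Z)
    join {Y} (_ , XHY) (_ , XHY') with am-e H cX (∀∈-++ Y XHY XHY')
    ... | Z , cZ , Y++Y'⊆Z , XHZ =
      Z , (cZ , XHZ) , (λ m → Y++Y'⊆Z (∈-++⁺ˡ m)) , (λ m → Y++Y'⊆Z (∈-++⁺ʳ Y m))

module Approximable {𝕊 𝕋 : CIS} (H : ApproxMap 𝕊 𝕋) where

  _⊩*_ : List (S 𝕊) → List (S 𝕊) → Set
  X ⊩* Y = X ⟨ entC 𝕊 ⟩* Y

  _H*_ : List (S 𝕊) → List (S 𝕋) → Set
  X H* Y = X ⟨ HC H ⟩* Y

  H*-along : ∀ {i j : ConSet 𝕊} {Y} →
             i ≡ j ⊎ proj₁ j ⊩* proj₁ i → proj₁ i H* Y → proj₁ j H* Y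
  H*-along (inj₁ refl) iHY = iHY
  H*-along {i} {j} (inj₂ j⊩i) iHY m = am-c H (proj₂ j) (proj₂ i) j⊩i (iHY m)

  module _ {X : List (S 𝕊)} (cX : CON 𝕊 X) where

    interpolateˡ : ∀ {Y} → X H* Y → Σ[ C ∈ List (S 𝕊) ] ((CON 𝕊 C × X ⊩* C) × C H* Y)
    interpolateˡ {Y} XHY =
      Image.merge (idMap 𝕊) cX (HC H) (λ cC cC' C⊆C' → am-b H cC' cC C⊆C') Y
        (λ m → pointwise (XHY m))
      where
      pointwise : ∀ {b} → HC H X b → Σ[ C ∈ List (S 𝕊) ] ((CON 𝕊 C × X ⊩* C) × HC H C b)
      pointwise XHb with am-d H cX XHb
      ... | C , C' , cC , cC' , X⊩C , CHC' , C'⊩b = C , (cC , X⊩C) , am-a H cC cC' CHC' C'⊩b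

    interpolateʳ : ∀ {Y} → X H* Y →
                   Σ[ E ∈ List (S 𝕋) ] ((CON 𝕋 E × X H* E) × E ⟨ entC 𝕋 ⟩* Y)
    interpolateʳ {Y} XHY = Image.merge H cX (entC 𝕋) (ax2 𝕋) Y (λ m → pointwise (XHY m))
      where
      pointwise : ∀ {b} → HC H X b → Σ[ E ∈ List (S 𝕋) ] ((CON 𝕋 E × X H* E) × entC 𝕋 E b)
      pointwise XHb with am-d H cX XHb
      ... | C , C' , cC , cC' , X⊩C , CHC' , C'⊩b =
        C' , (cC' , λ m → am-c H cX cC X⊩C (CHC' m)) , C'⊩b

    interpolateˡ* : (Ys : List (ConSet 𝕋)) → (∀ {Y} → Y ∈ Ys → X H* proj₁ Y) →
                    Σ[ C ∈ List (S 𝕊) ] ((CON 𝕊 C × X ⊩* C) × (∀ {Y} → Y ∈ Ys → C H* proj₁ Y))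
    interpolateˡ* Ys XHYs =
      Image.merge (idMap 𝕊) cX (λ C Y → C H* proj₁ Y)
        (λ cC cC' C⊆C' CHY m → am-b H cC' cC C⊆C' (CHY m)) Ys (λ m → interpolateˡ (XHYs m))

    interpolateʳ* : (Ys : List (ConSet 𝕋)) → (∀ {Y} → Y ∈ Ys → X H* proj₁ Y) →
                    Σ[ E ∈ List (S 𝕋) ]
                      ((CON 𝕋 E × X H* E) × (∀ {Y} → Y ∈ Ys → E ⟨ entC 𝕋 ⟩* proj₁ Y))
    interpolateʳ* Ys XHYs =
      Image.merge H cX (λ E Y → E ⟨ entC 𝕋 ⟩* proj₁ Y)
        (λ cE cE' E⊆E' E⊩Y m → ax2 𝕋 cE cE' E⊆E' (E⊩Y m)) Ys (λ m → interpolateʳ (XHYs m))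

module SystemFrame (𝕊 : CIS) where
  open Approximable (idMap 𝕊) public using (_⊩*_)
  open Approximable (idMap 𝕊) using (H*-along; interpolateʳ*)

  -- The first alternative makes {z} consistent at z, since ⊩ need not be reflexive.
  Con⁺ : ConSet 𝕊 → List (ConSet 𝕊) → Set
  Con⁺ z L = (∀ {t} → t ∈ L → t ≡ z) ⊎ (∀ {t} → t ∈ L → proj₁ z ⊩* proj₁ t)

  Ent⁺ : ConSet 𝕊 → List (ConSet 𝕊) → ConSet 𝕊 → Set
  Ent⁺ z L t = Con⁺ z L × proj₁ z ⊩* proj₁ t

  R⁺-elim : ∀ {i j} → Con⁺ j (i ∷ []) → i ≡ j ⊎ proj₁ j ⊩* proj₁ i
  R⁺-elim (inj₁ i≡j) = inj₁ (i≡j (here refl))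
  R⁺-elim (inj₂ j⊩i) = inj₂ (j⊩i (here refl))

  Con⁺-R⁺ : ∀ {i j} → Con⁺ j (i ∷ []) → ∀ {X} → Con⁺ i X → Con⁺ j X
  Con⁺-R⁺ (inj₁ i≡j) {X} cX = subst (λ k → Con⁺ k X) (i≡j (here refl)) cX
  Con⁺-R⁺ (inj₂ j⊩i) (inj₁ X≡i) =
    inj₂ (λ m → subst (λ k → _ ⊩* proj₁ k) (sym (X≡i m)) (j⊩i (here refl)))
  Con⁺-R⁺ rij (inj₂ i⊩X) = inj₂ (λ m → H*-along (R⁺-elim rij) (i⊩X m))

  frame : SCIF
  frame = record
    { A = ConSet 𝕊
    ; Con = Con⁺
    ; entF = Ent⁺
    ; entF-dom = proj₁
    ; f1 = λ _ → inj₁ singleton⁻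
    ; f2 = λ { Y⊆X (inj₁ X≡i) → inj₁ (λ m → X≡i (Y⊆X m))
             ; Y⊆X (inj₂ i⊩X) → inj₂ (λ m → i⊩X (Y⊆X m)) }
    ; f3 = λ _ X⊨Y → inj₂ (λ m → proj₂ (X⊨Y m))
    ; f4 = λ _ cY _ X⊨a → cY , proj₂ X⊨a
    ; f5 = λ cX _ Y⊨a → cX , proj₂ Y⊨a
    ; f6 = Con⁺-R⁺
    ; f7 = λ rij cX X⊨a → Con⁺-R⁺ rij cX , H*-along (R⁺-elim rij) (proj₂ X⊨a)
    ; f8 = λ {i} cX X⊨Y →
        let (E , (cE , i⊩E) , E⊩Y) = interpolateʳ* (proj₂ i) _ (λ m → proj₂ (X⊨Y m))
        in (E , cE) , [] , inj₁ (λ ()) , (λ { (here refl) → cX , i⊩E }) ,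
           (λ m → inj₁ (λ ()) , E⊩Y m)
    ; strong = isStrong
    }
    where
    isStrong : ∀ {i X} → Con⁺ i X → ¬ (X ≐ (i ∷ [])) → ∀ {b} → b ∈ X → Ent⁺ i (i ∷ []) b
    isStrong (inj₂ i⊩X) _ m = inj₁ singleton⁻ , i⊩X m
    isStrong {X = X} (inj₁ X≡i) X≉i m =
      ⊥-elim (X≉i ((λ m' → here (X≡i m')) , (λ { (here refl) → subst (_∈ X) (X≡i m) m })))

systemFrame : CIS → SCIF
systemFrame = SystemFrame.frame

liftRel : (𝕊 𝕋 : CIS) → RelC 𝕊 𝕋 → RelF (systemFrame 𝕊) (systemFrame 𝕋)
liftRel 𝕊 𝕋 R z L w = SystemFrame.Con⁺ 𝕊 z L × proj₁ z ⟨ R ⟩* proj₁ w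

liftRel-resp : (𝕊 𝕋 : CIS) {R R' : RelC 𝕊 𝕋} → EqC 𝕊 𝕋 R R' →
               EqF (systemFrame 𝕊) (systemFrame 𝕋) (liftRel 𝕊 𝕋 R) (liftRel 𝕊 𝕋 R')
liftRel-resp 𝕊 𝕋 R≈R' z _ _ _ =
  mk⇔ (λ (cL , zRw) → cL , λ m → to (R≈R' (proj₁ z) (proj₂ z) _) (zRw m))
      (λ (cL , zR'w) → cL , λ m → from (R≈R' (proj₁ z) (proj₂ z) _) (zR'w m))

mapFamily : {𝕊 𝕋 : CIS} → ApproxMap 𝕊 𝕋 → ApproxFam (systemFrame 𝕊) (systemFrame 𝕋)
mapFamily {𝕊} {𝕋} H = record
  { HF = liftRel 𝕊 𝕋 (HC H)
  ; HF-dom = proj₁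
  ; af-a = λ {i} {_} {k} _ _ XH[kY] Y⊨b →
      proj₁ (XH[kY] (here refl)) ,
      λ m → am-a H (proj₂ i) (proj₂ k) (proj₂ (XH[kY] (here refl))) (proj₂ Y⊨b m)
  ; af-b = λ _ cX' _ XHb → cX' , proj₂ XHb
  ; af-c = λ cX _ _ X'Hb → cX , proj₂ X'Hb
  ; af-d = λ rij cX XHb → Con⁺-R⁺ rij cX , H*-along (R⁺-elim rij) (proj₂ XHb)
  ; af-e = λ {i} cX XHF →
      let (E , (cE , iHE) , E⊩F) = interpolateʳ* (proj₂ i) _ (λ m → proj₂ (XHF m))
          (C , (cC , i⊩C) , CHE) = interpolateˡ (proj₂ i) iHE
      in (C , cC) , (E , cE) , [] , [] , inj₁ (λ ()) , inj₁ (λ ()) ,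
         (λ { (here refl) → cX , i⊩C }) , (λ { (here refl) → inj₁ (λ ()) , CHE }) ,
         (λ m → inj₁ (λ ()) , E⊩F m)
  }
  where
  open SystemFrame 𝕊 using (Con⁺-R⁺; R⁺-elim)
  open Approximable H

-- Strong continuous information frames

record PCon (𝔸 : SCIF) : Set where
  constructor pcon
  field
    pt  : A 𝔸
    cs  : List (A 𝔸)
    con : Con 𝔸 pt cs
open PCon

_⟨_⟩·_ : {𝔸 : SCIF} {B : Set} → PCon 𝔸 → (A 𝔸 → List (A 𝔸) → B → Set) → B → Set
s ⟨ R ⟩· b = R (pt s) (cs s) b

record _⟨_⟩▸_ {𝔸 𝔹 : SCIF} (s : PCon 𝔸) (R : RelF 𝔸 𝔹) (t : PCon 𝔹) : Set where
  constructor mk▸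
  field un▸ : ∀ {b} → b ∈ pt t ∷ cs t → s ⟨ R ⟩· b
open _⟨_⟩▸_

_⊳_ : {𝔸 : SCIF} → PCon 𝔸 → A 𝔸 → Set
_⊳_ {𝔸} s b = s ⟨ entF 𝔸 ⟩· b

_▷_ : {𝔸 : SCIF} → PCon 𝔸 → PCon 𝔸 → Set
_▷_ {𝔸} s t = s ⟨ entF 𝔸 ⟩▸ t

Top : {𝔸 : SCIF} → List (PCon 𝔸) → PCon 𝔸 → Set
Top X s = s ∈ X × (∀ {t} → t ∈ X → t ≡ s ⊎ s ▷ t)

HasTop : {𝔸 : SCIF} → List (PCon 𝔸) → Set
HasTop {𝔸} X = Σ (PCon 𝔸) (Top X)

top-[_] : {𝔸 : SCIF} (s : PCon 𝔸) → Top (s ∷ []) s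
top-[ s ] = here refl , λ m → inj₁ (singleton⁻ m)

Topped : {𝔸 𝔹 : SCIF} → RelF 𝔸 𝔹 → List (PCon 𝔸) → PCon 𝔹 → Set
Topped {𝔸} R X t = Σ[ s ∈ PCon 𝔸 ] (Top X s × s ⟨ R ⟩▸ t)

⊨-trans : (𝔸 : SCIF) → ∀ {i k X Y b} → Con 𝔸 i X → Con 𝔸 k Y →
          ent* 𝔸 i X (k ∷ Y) → entF 𝔸 k Y b → entF 𝔸 i X b
⊨-trans 𝔸 cX cY X⊨kY Y⊨b =
  f5 𝔸 cX (λ m → X⊨kY (there m)) (f7 𝔸 (f3 𝔸 cX λ { (here refl) → X⊨kY (here refl) }) cY Y⊨b)

▷⇒R : {𝔸 : SCIF} {s t : PCon 𝔸} → s ▷ t → R 𝔸 (pt t) (pt s)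
▷⇒R {𝔸} {s} s▷t = f3 𝔸 (con s) λ { (here refl) → un▸ s▷t (here refl) }

▷-⊳ : {𝔸 : SCIF} {s t : PCon 𝔸} {b : A 𝔸} → s ▷ t → t ⊳ b → s ⊳ b
▷-⊳ {𝔸} {s} {t} s▷t t⊳b = ⊨-trans 𝔸 (con s) (con t) (un▸ s▷t) t⊳b

▷-trans : {𝔸 : SCIF} {s t u : PCon 𝔸} → s ▷ t → t ▷ u → s ▷ u
▷-trans s▷t t▷u = mk▸ (λ m → ▷-⊳ s▷t (un▸ t▷u m))

idFam : (𝔸 : SCIF) → ApproxFam 𝔸 𝔸
idFam 𝔸 = record
  { HF = entF 𝔸
  ; HF-dom = entF-dom 𝔸
  ; af-a = ⊨-trans 𝔸
  ; af-b = f4 𝔸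
  ; af-c = λ cX _ → f5 𝔸 cX
  ; af-d = f7 𝔸
  ; af-e = λ cX X⊨F →
      let (e , Z , cZ , X⊨eZ , Z⊨F) = f8 𝔸 cX X⊨F
          (c , U , cU , X⊨cU , U⊨eZ) = f8 𝔸 cX X⊨eZ
      in c , e , U , Z , cU , cZ , X⊨cU , U⊨eZ , Z⊨F
  }

module Family {𝔸 𝔹 : SCIF} (H : ApproxFam 𝔸 𝔹) where

  _▶·_ : PCon 𝔸 → A 𝔹 → Set
  s ▶· b = s ⟨ HF H ⟩· b

  _▶_ : PCon 𝔸 → PCon 𝔹 → Set
  s ▶ t = s ⟨ HF H ⟩▸ t

  ▷-▶· : ∀ {s s' b} → s ▷ s' → s' ▶· b → s ▶· b
  ▷-▶· {s} {s'} s▷s' s'▶b =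
    af-c H (con s) (f6 𝔸 (▷⇒R s▷s') (con s')) (λ m → un▸ s▷s' (there m))
      (af-d H (▷⇒R s▷s') (con s') s'▶b)

  ▷-▶ : ∀ {s s' t} → s ▷ s' → s' ▶ t → s ▶ t
  ▷-▶ s▷s' s'▶t = mk▸ (λ m → ▷-▶· s▷s' (un▸ s'▶t m))

  ▶-▷· : ∀ {s t b} → s ▶ t → t ⊳ b → s ▶· b
  ▶-▷· {s} {t} s▶t t⊳b = af-a H (con s) (con t) (un▸ s▶t) t⊳b

  ▶-▷ : ∀ {s t u} → s ▶ t → t ▷ u → s ▶ u
  ▶-▷ s▶t t▷u = mk▸ (λ m → ▶-▷· s▶t (un▸ t▷u m))

  dominated-▶ : ∀ {s s' t} → s' ≡ s ⊎ s ▷ s' → s' ▶ t → s ▶ t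
  dominated-▶ (inj₁ refl) s'▶t = s'▶t
  dominated-▶ (inj₂ s▷s') s'▶t = ▷-▶ s▷s' s'▶t

  Topped-top : ∀ {X s} {t : PCon 𝔹} → Top X s → Topped (HF H) X t → s ▶ t
  Topped-top (_ , dom) (_ , (s'∈X , _) , s'▶t) = dominated-▶ (dom s'∈X) s'▶t

  ▶-factorʳ : ∀ {s} (T : List (A 𝔹)) → (∀ {b} → b ∈ T → s ▶· b) →
              Σ[ u ∈ PCon 𝔹 ] (s ▶ u × (∀ {b} → b ∈ T → u ⊳ b))
  ▶-factorʳ {s} T s▶T =
    let (c , e , U , V , cU , cV , s⊨cU , U▶eV , V⊨T) = af-e H (con s) s▶T
    in pcon e V cV , mk▸ (λ m → ▷-▶· {s} {pcon c U cU} (mk▸ s⊨cU) (U▶eV m)) , V⊨T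

  ▶·-factorˡ : ∀ {s b} → s ▶· b → Σ[ u ∈ PCon 𝔸 ] (s ▷ u × u ▶· b)
  ▶·-factorˡ {s} {b} s▶b =
    let (c , e , U , V , cU , cV , s⊨cU , U▶eV , V⊨b) =
          af-e H {F = b ∷ []} (con s) λ { (here refl) → s▶b }
    in pcon c U cU , mk▸ s⊨cU , af-a H cU cV U▶eV (V⊨b (here refl))

  ▶-merge : ∀ {s} {I : Set} (P : PCon 𝔹 → I → Set) → (∀ {u w x} → w ▷ u → P u x → P w x) →
            (xs : List I) → (∀ {x} → x ∈ xs → Σ[ u ∈ PCon 𝔹 ] (s ▶ u × P u x)) →
            Σ[ u ∈ PCon 𝔹 ] (s ▶ u × (∀ {x} → x ∈ xs → P u x))
  ▶-merge {s} P mono = Directed.merge (s ▶_) (λ u w → w ▷ u) empty join P (λ _ _ → mono)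
    where
    empty : Σ (PCon 𝔹) (s ▶_)
    empty = let (u , s▶u , _) = ▶-factorʳ [] (λ ()) in u , s▶u
    join : ∀ {u v} → s ▶ u → s ▶ v → Σ[ w ∈ PCon 𝔹 ] (s ▶ w × w ▷ u × w ▷ v)
    join {u} {v} s▶u s▶v =
      let (w , s▶w , w⊳uv) =
            ▶-factorʳ ((pt u ∷ cs u) ++ (pt v ∷ cs v)) (∀∈-++ (pt u ∷ cs u) (un▸ s▶u) (un▸ s▶v))
      in w , s▶w , mk▸ (λ m → w⊳uv (∈-++⁺ˡ m)) , mk▸ (λ m → w⊳uv (∈-++⁺ʳ (pt u ∷ cs u) m))

  ▶-bound : ∀ {s} (ts : List (PCon 𝔹)) → (∀ {t} → t ∈ ts → s ▶ t) →
            Σ[ u ∈ PCon 𝔹 ] (s ▶ u × (∀ {t} → t ∈ ts → u ▷ t))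
  ▶-bound ts s▶ts =
    ▶-merge _▷_ ▷-trans ts
      λ m → let (u , s▶u , u⊳t) = ▶-factorʳ _ (un▸ (s▶ts m)) in u , s▶u , mk▸ u⊳t

  Topped-resp-⊩ʳ : ∀ {X Y} {t : PCon 𝔹} → HasTop X → HasTop Y → X ⟨ Topped (HF H) ⟩* Y →
                   Topped (entF 𝔹) Y t → Topped (HF H) X t
  Topped-resp-⊩ʳ (s , topX) _ X▶Y (_ , topY , s'▷t) =
    s , topX , ▶-▷ (Topped-top topX (X▶Y (proj₁ topY))) s'▷t

  Topped-mono : ∀ {X X'} {t : PCon 𝔹} → HasTop X → HasTop X' → X' ⊆ X →
                Topped (HF H) X' t → Topped (HF H) X t
  Topped-mono (s , topX) _ X'⊆X (_ , (s'∈X' , _) , s'▶t) =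
    s , topX , dominated-▶ (proj₂ topX (X'⊆X s'∈X')) s'▶t

  Topped-resp-⊩ˡ : ∀ {X X'} {t : PCon 𝔹} → HasTop X → HasTop X' →
                   X ⟨ Topped (entF 𝔸) ⟩* X' → Topped (HF H) X' t → Topped (HF H) X t
  Topped-resp-⊩ˡ _ _ X▷X' (_ , topX' , s'▶t) =
    let (s , topX , s▷s') = X▷X' (proj₁ topX') in s , topX , ▷-▶ s▷s' s'▶t

  Topped-interpolate :
    ∀ {X : List (PCon 𝔸)} {t : PCon 𝔹} → HasTop X → Topped (HF H) X t →
    Σ[ Z ∈ List (PCon 𝔸) ] Σ[ Z' ∈ List (PCon 𝔹) ]
      (HasTop Z × HasTop Z' × X ⟨ Topped (entF 𝔸) ⟩* Z × Z ⟨ Topped (HF H) ⟩* Z' ×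
       Topped (entF 𝔹) Z' t)
  Topped-interpolate _ (s , topX , s▶t) =
    let (c , e , U , V , cU , cV , s⊨cU , U▶eV , V⊨t) = af-e H (con s) (un▸ s▶t)
        u = pcon c U cU
        v = pcon e V cV
    in (u ∷ []) , (v ∷ []) , (u , top-[ u ]) , (v , top-[ v ]) ,
       (λ { (here refl) → s , topX , mk▸ s⊨cU }) ,
       (λ { (here refl) → u , top-[ u ] , mk▸ U▶eV }) ,
       (v , top-[ v ] , mk▸ V⊨t)

  Topped-bound : ∀ {X : List (PCon 𝔸)} {F : List (PCon 𝔹)} → HasTop X →
                 X ⟨ Topped (HF H) ⟩* F →
                 Σ[ Z ∈ List (PCon 𝔹) ] (HasTop Z × F ⊆ Z × X ⟨ Topped (HF H) ⟩* Z)
  Topped-bound (s , topX) X▶F =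
    let (u , s▶u , u▷F) = ▶-bound _ (λ m → Topped-top topX (X▶F m))
    in (u ∷ _) , (u , here refl , λ { (here refl) → inj₁ refl ; (there m) → inj₂ (u▷F m) }) ,
       there , λ { (here refl) → s , topX , s▶u ; (there m) → X▶F m }

frameSystem : SCIF → CIS
frameSystem 𝔸 = record
  { S = PCon 𝔸
  ; CON = HasTop
  ; entC = Topped (entF 𝔸)
  ; CON-ext = λ (X⊆Y , Y⊆X) (s , s∈X , dom) → s , X⊆Y s∈X , λ m → dom (Y⊆X m)
  ; entC-dom = λ (s , topX , _) → s , topX
  ; ax1 = λ s → s , top-[ s ]
  ; ax2 = λ cX cY X⊆Y → Topped-mono cY cX X⊆Y
  ; ax3 = Topped-resp-⊩ʳ
  ; ax4 = λ cX X⊩a →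
      let (Z , Z' , cZ , cZ' , X⊩Z , Z⊩Z' , Z'⊩a) = Topped-interpolate cX X⊩a
      in Z , cZ , X⊩Z , Topped-resp-⊩ʳ cZ cZ' Z⊩Z' Z'⊩a
  ; ax5 = Topped-bound
  ; cont = λ _ (s , (s∈X , dom) , s▷a) →
      s , there s∈X , λ { (here refl) → inj₂ s▷a ; (there m) → dom m }
  }
  where open Family {𝔸} {𝔸} (idFam 𝔸)

familyMap : {𝔸 𝔹 : SCIF} → ApproxFam 𝔸 𝔹 → ApproxMap (frameSystem 𝔸) (frameSystem 𝔹)
familyMap {𝔸} {𝔹} H = record
  { HC = Topped (HF H)
  ; HC-dom = λ (s , topX , _) → s , topX
  ; am-a = Topped-resp-⊩ʳ
  ; am-b = Topped-mono
  ; am-c = Topped-resp-⊩ˡ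
  ; am-d = Topped-interpolate
  ; am-e = Topped-bound
  }
  where open Family {𝔸} {𝔹} H

Topped-resp : {𝔸 𝔹 : SCIF} {R R' : RelF 𝔸 𝔹} → EqF 𝔸 𝔹 R R' →
              EqC (frameSystem 𝔸) (frameSystem 𝔹) (Topped R) (Topped R')
Topped-resp R≈R' _ _ _ =
  mk⇔ (λ (s , topX , sRt) →
         s , topX , mk▸ (λ m → to (R≈R' (pt s) (cs s) (con s) _) (un▸ sRt m)))
      (λ (s , topX , sR't) →
         s , topX , mk▸ (λ m → from (R≈R' (pt s) (cs s) (con s) _) (un▸ sR't m)))

-- Unit and counit

module Unit (𝕊 : CIS) where
  open SystemFrame 𝕊 using (_⊩*_)
  open Approximable (idMap 𝕊) using (interpolateʳ; interpolateʳ*)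

  GF : CIS
  GF = frameSystem (systemFrame 𝕊)

  ⊩*-trans : ∀ {X Y W} → CON 𝕊 X → CON 𝕊 Y → X ⊩* Y → Y ⊩* W → X ⊩* W
  ⊩*-trans cX cY X⊩Y Y⊩W m = ax3 𝕊 cX cY X⊩Y (Y⊩W m)

  _⊩ᵖ_ : List (S 𝕊) → PCon (systemFrame 𝕊) → Set
  X ⊩ᵖ 𝔱 = ∀ {x} → x ∈ pt 𝔱 ∷ cs 𝔱 → X ⊩* proj₁ x

  ⌈_⌉ : ConSet 𝕊 → PCon (systemFrame 𝕊)
  ⌈ C ⌉ = pcon C [] (inj₁ (λ ()))

  ⌈⌉-▷ : ∀ {C 𝔱} → proj₁ C ⊩ᵖ 𝔱 → ⌈ C ⌉ ▷ 𝔱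
  ⌈⌉-▷ C⊩𝔱 = mk▸ (λ m → inj₁ (λ ()) , C⊩𝔱 m)

  ▷-⌈⌉ : ∀ {𝔰 C} → proj₁ (pt 𝔰) ⊩* proj₁ C → 𝔰 ▷ ⌈ C ⌉
  ▷-⌈⌉ {𝔰} 𝔰⊩C = mk▸ (λ { (here refl) → con 𝔰 , 𝔰⊩C })

  dominated-⊩ : ∀ {𝔰₀ 𝔰 : PCon (systemFrame 𝕊)} {a} → 𝔰 ≡ 𝔰₀ ⊎ 𝔰₀ ▷ 𝔰 →
                entC 𝕊 (proj₁ (pt 𝔰)) a → entC 𝕊 (proj₁ (pt 𝔰₀)) a
  dominated-⊩ (inj₁ refl) 𝔰⊩a = 𝔰⊩a
  dominated-⊩ {𝔰₀} {𝔰} (inj₂ 𝔰₀▷𝔰) 𝔰⊩a =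
    ax3 𝕊 (proj₂ (pt 𝔰₀)) (proj₂ (pt 𝔰)) (proj₂ (un▸ 𝔰₀▷𝔰 (here refl))) 𝔰⊩a

  unitRel : RelC 𝕊 GF
  unitRel X 𝔱 = CON 𝕊 X × X ⊩ᵖ 𝔱

  unit⁻Rel : RelC GF 𝕊
  unit⁻Rel 𝒳 a = Σ[ 𝔰 ∈ PCon (systemFrame 𝕊) ] (Top 𝒳 𝔰 × entC 𝕊 (proj₁ (pt 𝔰)) a)

  Top-⊩ : ∀ {𝒳 𝔰₀ a} → Top 𝒳 𝔰₀ → unit⁻Rel 𝒳 a → entC 𝕊 (proj₁ (pt 𝔰₀)) a
  Top-⊩ (_ , dom) (_ , (𝔰∈𝒳 , _) , 𝔰⊩a) = dominated-⊩ (dom 𝔰∈𝒳) 𝔰⊩a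

  unit : ApproxMap 𝕊 GF
  unit = record
    { HC = unitRel
    ; HC-dom = proj₁
    ; am-a = λ cX _ X▶Y (𝔰 , top𝔰 , 𝔰▷𝔱) →
        cX , λ m → ⊩*-trans cX (proj₂ (pt 𝔰)) (proj₂ (X▶Y (proj₁ top𝔰)) (here refl))
                     (proj₂ (un▸ 𝔰▷𝔱 m))
    ; am-b = λ cX cX' X'⊆X (_ , X'⊩𝔱) → cX , λ m m' → ax2 𝕊 cX' cX X'⊆X (X'⊩𝔱 m m')
    ; am-c = λ cX cX' X⊩X' (_ , X'⊩𝔱) → cX , λ m → ⊩*-trans cX cX' X⊩X' (X'⊩𝔱 m)
    ; am-d = λ {_} {𝔱} cX (_ , X⊩𝔱) →
        let (C , (cC , X⊩C) , C⊩𝔱) = interpolateʳ* cX (pt 𝔱 ∷ cs 𝔱) X⊩𝔱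
            (Z , (cZ , X⊩Z) , Z⊩C) = interpolateʳ cX X⊩C
        in Z , (⌈ C , cC ⌉ ∷ []) , cZ , (_ , top-[ _ ]) , X⊩Z ,
           (λ { (here refl) → cZ , λ { (here refl) → Z⊩C } }) , (_ , top-[ _ ] , ⌈⌉-▷ C⊩𝔱)
    ; am-e = λ {_} {F} cX X▶F →
        let (C , (cC , X⊩C) , C⊩F) =
              Image.merge (idMap 𝕊) cX _⊩ᵖ_
                (λ cC cC' C⊆C' C⊩𝔱 m m' → ax2 𝕊 cC cC' C⊆C' (C⊩𝔱 m m')) F
                (λ {𝔱} m → interpolateʳ* cX (pt 𝔱 ∷ cs 𝔱) (proj₂ (X▶F m)))
        in (⌈ C , cC ⌉ ∷ F) ,
           (_ , here refl , λ { (here refl) → inj₁ refl ; (there m) → inj₂ (⌈⌉-▷ (C⊩F m)) }) ,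
           there , λ { (here refl) → cX , λ { (here refl) → X⊩C } ; (there m) → X▶F m }
    }

  unit⁻ : ApproxMap GF 𝕊
  unit⁻ = record
    { HC = unit⁻Rel
    ; HC-dom = λ (𝔰 , top𝔰 , _) → 𝔰 , top𝔰
    ; am-a = λ (𝔰₀ , top₀) cY 𝒳▶Y Y⊩a →
        𝔰₀ , top₀ , ax3 𝕊 (proj₂ (pt 𝔰₀)) cY (λ m → Top-⊩ top₀ (𝒳▶Y m)) Y⊩a
    ; am-b = λ (𝔰₀ , top₀) _ 𝒳'⊆𝒳 (_ , (𝔰∈𝒳' , _) , 𝔰⊩a) →
        𝔰₀ , top₀ , dominated-⊩ (proj₂ top₀ (𝒳'⊆𝒳 𝔰∈𝒳')) 𝔰⊩a
    ; am-c = λ _ _ 𝒳⊩𝒳' (_ , top' , 𝔰'⊩a) →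
        let (𝔰 , top𝔰 , 𝔰▷𝔰') = 𝒳⊩𝒳' (proj₁ top')
        in 𝔰 , top𝔰 , dominated-⊩ (inj₂ 𝔰▷𝔰') 𝔰'⊩a
    ; am-d = λ _ (𝔰 , top𝔰 , 𝔰⊩a) →
        let (C , E , cC , cE , 𝔰⊩C , C⊩E , E⊩a) = am-d (idMap 𝕊) (proj₂ (pt 𝔰)) 𝔰⊩a
        in (⌈ C , cC ⌉ ∷ []) , E , (_ , top-[ _ ]) , cE ,
           (λ { (here refl) → 𝔰 , top𝔰 , ▷-⌈⌉ 𝔰⊩C }) , (λ m → _ , top-[ _ ] , C⊩E m) , E⊩a
    ; am-e = λ (𝔰₀ , top₀) 𝒳▶F →
        let (Z , cZ , F⊆Z , 𝔰₀⊩Z) = ax5 𝕊 (proj₂ (pt 𝔰₀)) (λ m → Top-⊩ top₀ (𝒳▶F m))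
        in Z , cZ , F⊆Z , λ m → 𝔰₀ , top₀ , 𝔰₀⊩Z m
    }

top : {𝔸 : SCIF} → ConSet (frameSystem 𝔸) → PCon 𝔸
top z = proj₁ (proj₂ z)

top-Top : {𝔸 : SCIF} (z : ConSet (frameSystem 𝔸)) → Top (proj₁ z) (top z)
top-Top z = proj₂ (proj₂ z)

[_]ᵀ : {𝔸 : SCIF} → PCon 𝔸 → ConSet (frameSystem 𝔸)
[ u ]ᵀ = (u ∷ []) , u , top-[ u ]

module Counit (𝔸 : SCIF) where
  open SystemFrame (frameSystem 𝔸) using (_⊩*_; Con⁺; Con⁺-R⁺; R⁺-elim)
  open Family {𝔸} {𝔸} (idFam 𝔸) using (▶-factorʳ; ▶-merge; ▶-bound; Topped-top)

  FG : SCIF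
  FG = systemFrame (frameSystem 𝔸)

  top-▷ : ∀ {z z' : ConSet (frameSystem 𝔸)} → proj₁ z ⊩* proj₁ z' → top z ▷ top z'
  top-▷ {z} {z'} z⊩z' = Topped-top (top-Top z) (z⊩z' (proj₁ (top-Top z')))

  counitRel : RelF FG 𝔸
  counitRel z L b = Con⁺ z L × top z ⊳ b

  counit⁻Rel : RelF 𝔸 FG
  counit⁻Rel i Y z = Con 𝔸 i Y × (∀ {t} → t ∈ proj₁ z → Y ⟨ entF 𝔸 i ⟩* (pt t ∷ cs t))

  counit : ApproxFam FG 𝔸
  counit = record
    { HF = counitRel
    ; HF-dom = proj₁
    ; af-a = λ {z} {_} {k} _ cY L▶kY Y⊨b →
        proj₁ (L▶kY (here refl)) ,
        ▷-⊳ {s = top z} {pcon k _ cY} (mk▸ (λ m → proj₂ (L▶kY m))) Y⊨b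
    ; af-b = λ _ cL' _ L▶b → cL' , proj₂ L▶b
    ; af-c = λ cL _ _ L'▶b → cL , proj₂ L'▶b
    ; af-d = λ rzz' cL L▶b → Con⁺-R⁺ rzz' cL , top-along (R⁺-elim rzz') (proj₂ L▶b)
    ; af-e = λ {z} {_} {F} cL L▶F →
        let (u , z▷u , u⊳F) = ▶-factorʳ {top z} F (λ m → proj₂ (L▶F m))
            (u' , z▷u' , u'⊳u) = ▶-factorʳ {top z} (pt u ∷ cs u) (un▸ z▷u)
        in [ u' ]ᵀ , pt u , [] , cs u , inj₁ (λ ()) , con u ,
           (λ { (here refl) → cL , λ { (here refl) → top z , top-Top z , z▷u' } }) ,
           (λ m → inj₁ (λ ()) , u'⊳u m) , u⊳F
    }
    where
    top-along : ∀ {z' z : ConSet (frameSystem 𝔸)} {b} →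
                z' ≡ z ⊎ proj₁ z ⊩* proj₁ z' → top z' ⊳ b → top z ⊳ b
    top-along (inj₁ refl) z'⊳b = z'⊳b
    top-along {z'} {z} (inj₂ z⊩z') z'⊳b = ▷-⊳ (top-▷ {z} {z'} z⊩z') z'⊳b

  counit⁻ : ApproxFam 𝔸 FG
  counit⁻ = record
    { HF = counit⁻Rel
    ; HF-dom = proj₁
    ; af-a = λ {i} {X} cX _ X▶kY Y⊨z →
        cX , λ m → let (_ , (s∈k , _) , s▷t) = proj₂ Y⊨z m
                   in un▸ (▷-trans {s = pcon i X cX} (mk▸ (proj₂ (X▶kY (here refl)) s∈k)) s▷t)
    ; af-b = λ cX cX' X⊆X' (_ , X▶z) → cX' , λ m m' → f4 𝔸 cX cX' X⊆X' (X▶z m m')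
    ; af-c = λ cX _ X⊨X' (_ , X'▶z) → cX , λ m m' → f5 𝔸 cX X⊨X' (X'▶z m m')
    ; af-d = λ rij cX (_ , X▶z) → f6 𝔸 rij cX , λ m m' → f7 𝔸 rij cX (X▶z m m')
    ; af-e = λ {i} {Y} {F} cY Y▶F →
        let (u , Y▷u , u▷F) =
              ▶-merge {pcon i Y cY} (λ u z → ∀ {t} → t ∈ proj₁ z → u ▷ t)
                (λ w▷u u▷z m → ▷-trans w▷u (u▷z m)) F
                (λ {z} m → ▶-bound (proj₁ z) (λ m' → mk▸ (proj₂ (Y▶F m) m')))
            (u' , Y▷u' , u'⊳u) = ▶-factorʳ {pcon i Y cY} (pt u ∷ cs u) (un▸ Y▷u)
        in pt u' , [ u ]ᵀ , cs u' , [] , con u' , inj₁ (λ ()) , un▸ Y▷u' ,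
           (λ { (here refl) → con u' , λ { (here refl) → u'⊳u } }) ,
           (λ m → inj₁ (λ ()) , λ m' → u , top-[ u ] , u▷F m m')
    }

-- Functoriality, inverse laws and naturality

mapFamily-∘ : {𝕊₁ 𝕊₂ 𝕊₃ : CIS}
              (G : ApproxMap 𝕊₁ 𝕊₂) (H : ApproxMap 𝕊₂ 𝕊₃) (K : ApproxMap 𝕊₁ 𝕊₃) →
              EqC 𝕊₁ 𝕊₃ (HC K) (compC 𝕊₁ 𝕊₂ 𝕊₃ (HC G) (HC H)) →
              EqF (systemFrame 𝕊₁) (systemFrame 𝕊₃) (HF (mapFamily K))
                (compF (systemFrame 𝕊₁) (systemFrame 𝕊₂) (systemFrame 𝕊₃)
                  (HF (mapFamily G)) (HF (mapFamily H)))
mapFamily-∘ G H K K≈G∘H z _ cL w = mk⇔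
  (λ (_ , zKw) →
     let (E , (cE , zGE) , EHw) =
           Image.merge G (proj₂ z) (HC H) (λ cE cE' E⊆E' → am-b H cE' cE E⊆E') (proj₁ w)
             λ m → let (Y , cY , zGY , YHb) = to (K≈G∘H (proj₁ z) (proj₂ z) _) (zKw m)
                   in Y , (cY , zGY) , YHb
     in (E , cE) , [] , inj₁ (λ ()) , (λ { (here refl) → cL , zGE }) , (inj₁ (λ ()) , EHw))
  (λ (e , _ , _ , L▶eV , (_ , eHw)) →
     cL , λ m → from (K≈G∘H (proj₁ z) (proj₂ z) _)
                  (proj₁ e , proj₂ e , proj₂ (L▶eV (here refl)) , eHw m))

familyMap-∘ : {𝔸₁ 𝔸₂ 𝔸₃ : SCIF}
              (G : ApproxFam 𝔸₁ 𝔸₂) (H : ApproxFam 𝔸₂ 𝔸₃) (K : ApproxFam 𝔸₁ 𝔸₃) →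
              EqF 𝔸₁ 𝔸₃ (HF K) (compF 𝔸₁ 𝔸₂ 𝔸₃ (HF G) (HF H)) →
              EqC (frameSystem 𝔸₁) (frameSystem 𝔸₃) (HC (familyMap K))
                (compC (frameSystem 𝔸₁) (frameSystem 𝔸₂) (frameSystem 𝔸₃)
                  (HC (familyMap G)) (HC (familyMap H)))
familyMap-∘ {𝔸₁} {𝔸₂} {𝔸₃} G H K K≈G∘H _ _ t = mk⇔
  (λ (s , topX , s▶t) →
     let (w , s▶w , w▶t) =
           Family.▶-merge {𝔸₁} {𝔸₂} G {s} (λ w x → w ⟨ HF H ⟩· x)
             (Family.▷-▶· {𝔸₂} {𝔸₃} H) (pt t ∷ cs t)
             λ m → let (e , W , cW , sGeW , WHx) = to (K≈G∘H (pt s) (cs s) (con s) _) (un▸ s▶t m)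
                   in pcon e W cW , mk▸ sGeW , WHx
     in (w ∷ []) , (w , top-[ w ]) , (λ { (here refl) → s , topX , s▶w }) ,
        (w , top-[ w ] , mk▸ w▶t))
  (λ (_ , _ , X▶Y , (s' , topY , s'▶t)) →
     let (s , topX , s▶s') = X▶Y (proj₁ topY)
     in s , topX ,
        mk▸ (λ m → from (K≈G∘H (pt s) (cs s) (con s) _)
                     (pt s' , cs s' , con s' , un▸ s▶s' , un▸ s'▶t m)))

module _ (𝕊 : CIS) where
  open Unit 𝕊
  open Approximable (idMap 𝕊) using (interpolateʳ*)

  unit-inverseˡ : EqC 𝕊 𝕊 (compC 𝕊 GF 𝕊 (HC unit) (HC unit⁻)) (idC 𝕊)
  unit-inverseˡ _ cX _ = mk⇔
    (λ (_ , _ , X▶𝒴 , (𝔰 , top𝔰 , 𝔰⊩b)) →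
       ax3 𝕊 cX (proj₂ (pt 𝔰)) (proj₂ (X▶𝒴 (proj₁ top𝔰)) (here refl)) 𝔰⊩b)
    (λ X⊩b →
       let (C , cC , X⊩C , C⊩b) = ax4 𝕊 cX X⊩b
       in (⌈ C , cC ⌉ ∷ []) , (_ , top-[ _ ]) ,
          (λ { (here refl) → cX , λ { (here refl) → X⊩C } }) , (_ , top-[ _ ] , C⊩b))

  unit-inverseʳ : EqC GF GF (compC GF 𝕊 GF (HC unit⁻) (HC unit)) (idC GF)
  unit-inverseʳ _ (𝔰₀ , top₀) 𝔱 = mk⇔
    (λ (_ , cY , 𝒳▶Y , (_ , Y⊩𝔱)) →
       𝔰₀ , top₀ ,
       mk▸ (λ m → con 𝔰₀ , ⊩*-trans (proj₂ (pt 𝔰₀)) cY (λ m' → Top-⊩ top₀ (𝒳▶Y m')) (Y⊩𝔱 m)))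
    (λ (𝔰 , top𝔰 , 𝔰▷𝔱) →
       let (C , (cC , 𝔰⊩C) , C⊩𝔱) =
             interpolateʳ* (proj₂ (pt 𝔰)) (pt 𝔱 ∷ cs 𝔱) (λ m → proj₂ (un▸ 𝔰▷𝔱 m))
       in C , cC , (λ m → 𝔰 , top𝔰 , 𝔰⊩C m) , (cC , C⊩𝔱))

unit-natural : {𝕊 𝕋 : CIS} (H : ApproxMap 𝕊 𝕋) →
               EqC 𝕊 (Unit.GF 𝕋) (compC 𝕊 𝕋 (Unit.GF 𝕋) (HC H) (HC (Unit.unit 𝕋)))
                 (compC 𝕊 (Unit.GF 𝕊) (Unit.GF 𝕋) (HC (Unit.unit 𝕊))
                   (HC (familyMap (mapFamily H))))
unit-natural {𝕊} H _ cX 𝔱 = mk⇔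
  (λ (_ , cY , XHY , (_ , Y⊩𝔱)) →
     let (C , (cC , X⊩C) , CH𝔱) =
           interpolateˡ* cX (pt 𝔱 ∷ cs 𝔱) (λ m m' → am-a H cX cY XHY (Y⊩𝔱 m m'))
     in (Unit.⌈ 𝕊 ⌉ (C , cC) ∷ []) , (_ , top-[ _ ]) ,
        (λ { (here refl) → cX , λ { (here refl) → X⊩C } }) ,
        (_ , top-[ _ ] , mk▸ (λ m → inj₁ (λ ()) , CH𝔱 m)))
  (λ (_ , _ , X▶𝒴 , (𝔰 , top𝔰 , 𝔰▶𝔱)) →
     let X⊩𝔰 = proj₂ (X▶𝒴 (proj₁ top𝔰)) (here refl)
         (E , (cE , XHE) , E⊩𝔱) =
           interpolateʳ* cX (pt 𝔱 ∷ cs 𝔱)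
             (λ m m' → am-c H cX (proj₂ (pt 𝔰)) X⊩𝔰 (proj₂ (un▸ 𝔰▶𝔱 m) m'))
     in E , cE , XHE , (cE , E⊩𝔱))
  where open Approximable H

module _ (𝔸 : SCIF) where
  open Counit 𝔸
  open Family {𝔸} {𝔸} (idFam 𝔸) using (▶-factorʳ; ▶-bound; Topped-top)

  counit-inverseˡ : EqF FG FG (compF FG 𝔸 FG (HF counit) (HF counit⁻)) (idF FG)
  counit-inverseˡ z _ cL w = mk⇔
    (λ (e , V , cV , L▶eV , (_ , V▶w)) →
       cL , λ m → top z , top-Top z ,
                  ▷-trans {s = top z} {pcon e V cV} (mk▸ (λ m' → proj₂ (L▶eV m'))) (mk▸ (V▶w m)))
    (λ (_ , z⊩w) →
       let (u , z▷u , u▷w) = ▶-bound {top z} (proj₁ w) (λ m → Topped-top (top-Top z) (z⊩w m))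
       in pt u , cs u , con u , (λ m → cL , un▸ z▷u m) , (con u , λ m → un▸ (u▷w m)))

  counit-inverseʳ : EqF 𝔸 𝔸 (compF 𝔸 FG 𝔸 (HF counit⁻) (HF counit)) (idF 𝔸)
  counit-inverseʳ i Y cY b = mk⇔
    (λ (z , _ , _ , Y▶z𝒱 , (_ , z⊳b)) →
       ▷-⊳ {s = pcon i Y cY} {top z} (mk▸ (proj₂ (Y▶z𝒱 (here refl)) (proj₁ (top-Top z)))) z⊳b)
    (λ Y⊨b →
       let (u , Y▷u , u⊳b) = ▶-factorʳ {pcon i Y cY} (b ∷ []) (λ { (here refl) → Y⊨b })
       in [ u ]ᵀ , [] , inj₁ (λ ()) ,
          (λ { (here refl) → cY , (λ { (here refl) → un▸ Y▷u }) ; (there ()) }) ,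
          (inj₁ (λ ()) , u⊳b (here refl)))

counit-natural : {𝔸 𝔹 : SCIF} (H : ApproxFam 𝔸 𝔹) →
                 EqF (Counit.FG 𝔸) 𝔹
                   (compF (Counit.FG 𝔸) (Counit.FG 𝔹) 𝔹
                     (HF (mapFamily (familyMap H))) (HF (Counit.counit 𝔹)))
                   (compF (Counit.FG 𝔸) 𝔸 𝔹 (HF (Counit.counit 𝔸)) (HF H))
counit-natural {𝔸} {𝔹} H z _ cL b = mk⇔
  (λ (w , _ , _ , L▶w𝒱 , (_ , w⊳b)) →
     let z▶w = Topped-top (top-Top z) (proj₂ (L▶w𝒱 (here refl)) (proj₁ (top-Top w)))
         (u , z▷u , u▶b) = ▶·-factorˡ {top z} (▶-▷· z▶w w⊳b)
     in pt u , cs u , con u , (λ m → cL , un▸ z▷u m) , u▶b)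
  (λ (e , V , cV , L▶eV , V▶b) →
     let z▶b = ▷-▶· {top z} {pcon e V cV} (mk▸ (λ m → proj₂ (L▶eV m))) V▶b
         (u , z▶u , u⊳b) = ▶-factorʳ {top z} (b ∷ []) (λ { (here refl) → z▶b })
     in [ u ]ᵀ , [] , inj₁ (λ ()) ,
        (λ { (here refl) → cL , λ { (here refl) → top z , top-Top z , z▶u } }) ,
        (inj₁ (λ ()) , u⊳b (here refl)))
  where open Family {𝔸} {𝔹} H

theorem4p32 : CIS≃SIF
theorem4p32 = record
  { F₀ = systemFrame
  ; F₁ = mapFamily
  ; F-resp = λ {𝕊} {𝕋} _ _ → liftRel-resp 𝕊 𝕋
    -- idC and idF are definitionally lifts of ⊩ and ⊨, so F-id and G-id are instances of respect.
  ; F-id = λ {𝕊} _ → liftRel-resp 𝕊 𝕊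
  ; F-comp = mapFamily-∘
  ; G₀ = frameSystem
  ; G₁ = familyMap
  ; G-resp = λ _ _ → Topped-resp
  ; G-id = λ _ → Topped-resp
  ; G-comp = familyMap-∘
  ; η = Unit.unit
  ; η⁻ = Unit.unit⁻
  ; η-inv₁ = unit-inverseˡ
  ; η-inv₂ = unit-inverseʳ
  ; η-nat = unit-natural
  ; ε = Counit.counit
  ; ε⁻ = Counit.counit⁻
  ; ε-inv₁ = counit-inverseˡ
  ; ε-inv₂ = counit-inverseʳ
  ; ε-nat = counit-natural
  }
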